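{- Let $C\subseteq\mathbb{R}^\infty_{\ge0}$ be a $\mathrm{Sym}$-invariant cone and let $\overline{C}_n=C\cap\mathbb{R}^n$ for $n\ge1$, forming the chain $\overline{\mathcal{C}}=(\overline{C}_n)_{n\ge1}$. The following are equivalent: (i) $C$ is $\mathrm{Sym}$-equivariantly finitely generated; (ii) $\overline{\mathcal{C}}$ stabilizes and $\overline{C}_n$ is finitely generated for all $n\ge1$; (iii) there exists $s\in\mathbb{N}$ such that for all $n\ge1$, $\overline{C}_n$ is generated by finitely many elements of support size at most $s$.
   Context: $\mathbb{R}^\infty$ is the set of real sequences with finitely many nonzero entries, $\mathbb{R}^\infty_{\ge0}$ those with nonnegative entries; $\mathbb{R}^n$ is identified with sequences vanishing after position $n$. Support size of $u$ is $|\{i:u_i\ne0\}|$. $\mathrm{Sym}$ is the group of permutations of $\mathbb{N}$ fixing all but finitely many points, $\mathrm{Sym}(n)$ the symmetric group on $\{1,\dots,n\}$, acting by $\sigma(u)_i=u_{\sigma^{ -1}(i)}$; $\mathrm{Sym}(A)$, $\mathrm{Sym}(n)(A)$ are orbit sets; $\mathrm{cn}(A)$ is the set of finite nonnegative real combinations. $C$ is $\mathrm{Sym}$-equivariantly finitely generated if $C=\mathrm{cn}(\mathrm{Sym}(A))$ for finite $A$. A chain $(C_n)$ with $C_n\subseteq\mathbb{R}^n$ stabilizes if there is $r$ with $C_n=\mathrm{cn}(\mathrm{Sym}(n)(C_m))$ for all $n\ge m\ge r$. -}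

module Defs where

open import Level using (0ℓ)
open import Data.Nat using (ℕ; _≤_) renaming (zero to zeroℕ)
open import Data.Product using (Σ; ∃; ∃-syntax; _×_; _,_)
open import Data.List using (List; []; _∷_; length)
open import Data.List.Relation.Unary.All using (All)
open import Data.List.Relation.Unary.Any using (Any)
open import Data.List.Membership.Propositional using (_∈_)
open import Relation.Binary.PropositionalEquality using (_≡_)
open import Relation.Nullary using (¬_)
open import Function.Bundles using (_⇔_)
import Algebra.Structures as AS
import Relation.Binary.Structures as RS

-- The real numbers, given axiomatically as a complete ordered field
-- (which characterises ℝ up to unique isomorphism).  Equality is _≡_.

record RealField : Set₁ where
  infixl 6 _+_
  infixl 7 _*_
  infix 4 _≤ᵣ_
  field
    Carrier : Set
    _+_ _*_ : Carrier → Carrier → Carrier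
    -_      : Carrier → Carrier
    0# 1#   : Carrier
    _≤ᵣ_     : Carrier → Carrier → Set
    isCommutativeRing : AS.IsCommutativeRing _≡_ _+_ _*_ -_ 0# 1#
    0≢1     : ¬ (0# ≡ 1#)
    inverse : ∀ x → ¬ (x ≡ 0#) → ∃[ y ] (x * y ≡ 1#)
    isTotalOrder : RS.IsTotalOrder _≡_ _≤ᵣ_
    +-mono  : ∀ {x y} z → x ≤ᵣ y → x + z ≤ᵣ y + z
    *-nonneg : ∀ {x y} → 0# ≤ᵣ x → 0# ≤ᵣ y → 0# ≤ᵣ x * y
    complete : (S : Carrier → Set) → (∃[ x ] S x) → (∃[ b ] (∀ x → S x → x ≤ᵣ b)) →
               ∃[ s ] ((∀ x → S x → x ≤ᵣ s) × (∀ b → (∀ x → S x → x ≤ᵣ b) → s ≤ᵣ b))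

-- Permutations of ℕ (positions are 0-based: position i here is i+1 in
-- the paper).

record Perm : Set where
  field
    fun inv : ℕ → ℕ
    inv-fun : ∀ i → inv (fun i) ≡ i
    fun-inv : ∀ i → fun (inv i) ≡ i
open Perm public

InSym : Perm → Set
InSym σ = ∃[ N ] (∀ i → N ≤ i → fun σ i ≡ i)

InSymN : ℕ → Perm → Set
InSymN n σ = ∀ i → n ≤ i → fun σ i ≡ i

module WithReals (ℝ : RealField) where
  open RealField ℝ

  -- real sequences; a "set" of sequences is a predicate respecting ≐
  Seq : Set
  Seq = ℕ → Carrier

  _≐_ : Seq → Seq → Set
  u ≐ v = ∀ i → u i ≡ v i

  Subset : Set₁
  Subset = Seq → Set

  IsSet : Subset → Set
  IsSet A = ∀ {u v} → u ≐ v → A u → A v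

  _≋_ : Subset → Subset → Set
  A ≋ B = ∀ u → (A u ⇔ B u)

  zeroSeq : Seq
  zeroSeq i = 0#

  _⊕_ : Seq → Seq → Seq
  (u ⊕ v) i = u i + v i

  _·_ : Carrier → Seq → Seq
  (λ' · u) i = λ' * u i

  InR∞ : Seq → Set
  InR∞ u = ∃[ N ] (∀ i → N ≤ i → u i ≡ 0#)

  InRn : ℕ → Seq → Set
  InRn n u = ∀ i → n ≤ i → u i ≡ 0#

  Nonneg : Seq → Set
  Nonneg u = ∀ i → 0# ≤ᵣ u i

  SuppAtMost : ℕ → Seq → Set
  SuppAtMost s u = ∃[ I ] (length I ≤ s × (∀ i → ¬ (u i ≡ 0#) → i ∈ I))

  act : Perm → Seq → Seq
  act σ u i = u (inv σ i)

  lincomb : List (Carrier × Seq) → Seq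
  lincomb [] = zeroSeq
  lincomb ((c , v) ∷ xs) = (c · v) ⊕ lincomb xs

  cn : Subset → Subset
  cn A u = ∃[ xs ] (All (λ { (c , v) → (0# ≤ᵣ c) × A v }) xs × (u ≐ lincomb xs))

  SymOrb : Subset → Subset
  SymOrb A v = ∃[ σ ] (InSym σ × ∃[ a ] (A a × (v ≐ act σ a)))

  SymNOrb : ℕ → Subset → Subset
  SymNOrb n A v = ∃[ σ ] (InSymN n σ × ∃[ a ] (A a × (v ≐ act σ a)))

  ofList : List Seq → Subset
  ofList L v = Any (λ a → v ≐ a) L

  IsCone : Subset → Set
  IsCone C = C zeroSeq × (∀ {u v} → C u → C v → C (u ⊕ v))
             × (∀ {c u} → 0# ≤ᵣ c → C u → C (c · u))

  SymInvariant : Subset → Set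
  SymInvariant C = ∀ σ → InSym σ → ∀ {u} → C u → C (act σ u)

  EqFinGen : Subset → Set
  EqFinGen C = ∃[ A ] (C ≋ cn (SymOrb (ofList A)))

  FinGen : Subset → Set
  FinGen D = ∃[ A ] (D ≋ cn (ofList A))

  Cbar : Subset → ℕ → Subset
  Cbar C n u = C u × InRn n u

  Stabilizes : (ℕ → Subset) → Set
  Stabilizes D = ∃[ r ] (∀ m n → 1 ≤ m → r ≤ m → m ≤ n →
                          D n ≋ cn (SymNOrb n (D m)))

  BoundedSupportGen : Subset → Set
  BoundedSupportGen C = ∃[ s ] (∀ n → 1 ≤ n →
    ∃[ A ] (All (SuppAtMost s) A × (Cbar C n ≋ cn (ofList A))))

-- (ii) ⇒ (i): pick generators of C̄ₘ for m beyond the stabilization index; every u ∈ C lies in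
-- some C̄ₙ, hence is a combination of Sym(n)-translates of C̄ₘ and so of Sym-translates of the
-- generators.
-- (iii) ⇒ (ii): a generator of C̄ₙ with support size at most s is moved into ℝᵐ, m > s, by a
-- permutation of {0,…,n-1}, so C̄ₙ is generated by the Sym(n)-orbit of C̄ₘ.
-- (i) ⇒ (iii): let A ⊆ ℝᴺ generate C equivariantly. Since C is nonnegative, an element of C̄ₙ is a
-- combination of orbit elements σ a lying in ℝⁿ, and each such σ a equals τ a for a permutation τ
-- realising one of the finitely many maps {0,…,N-1} → {0,…,n+N-1}; these τ a have support size
-- at most N.
-- The case distinctions x = 0 or x ≠ 0 are constructive: completeness, applied to arbitrary
-- predicates, yields weak excluded middle and ¬¬-stability of x ≡ 0.

module Submission where

open import Defs
open import Level using (0ℓ)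
open import Data.Nat using (ℕ; zero; suc; _≤_; _<_; _≟_; _<?_; _⊔_; z≤n; s≤s)
open import Data.Nat.Properties
  using ( ≤-refl; ≤-trans; ≤-pred; ≤-reflexive; <⇒≤; <⇒≱; ≮⇒≥; <-irrefl; ≤∧≢⇒<; <-≤-trans
        ; m<n⇒m<1+n; n≤1+n; m≤m+n; m≤n+m; m≤m⊔n; m≤n⊔m; +-monoʳ-<; +-cancelˡ-≡; allUpTo?)
open import Data.Product using (_×_; _,_; proj₁; proj₂; ∃-syntax; map₁; map₂; uncurry)
open import Data.Sum using (_⊎_; inj₁; inj₂; [_,_]′)
open import Data.Empty using (⊥-elim)
open import Data.List using (List; []; _∷_; _++_; length; map; concatMap; filter; upTo; applyUpTo)
open import Data.List.Properties using (length-applyUpTo)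
open import Data.List.Relation.Unary.All using (All; []; _∷_)
import Data.List.Relation.Unary.All as All
import Data.List.Relation.Unary.All.Properties as All
open import Data.List.Relation.Unary.Any using (Any; here; there)
import Data.List.Relation.Unary.Any as Any
import Data.List.Relation.Unary.Any.Properties as Any
open import Data.List.Membership.Propositional using (_∈_; find)
open import Data.List.Membership.Propositional.Properties using (∈-upTo⁺; ∈-applyUpTo⁺; ∈-map⁺; ∈-filter⁺)
open import Relation.Nullary using (¬_; Dec; yes; no)
open import Relation.Nullary.Decidable using (_⊎-dec_)
open import Relation.Binary.PropositionalEquality
open import Function.Base using (_∘_)
open import Function.Bundles using (_⇔_; mk⇔; Equivalence)
open import Algebra.Bundles using (CommutativeRing)
import Algebra.Properties.Ring as RingProperties
import Algebra.Properties.Group as GroupProperties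
import Relation.Binary.Structures as RS

transpose : ℕ → ℕ → ℕ → ℕ
transpose i j k with k ≟ i | k ≟ j
... | yes _ | _     = j
... | no _  | yes _ = i
... | no _  | no _  = k

transpose-≡ˡ : ∀ i j → transpose i j i ≡ j
transpose-≡ˡ i j with i ≟ i
... | yes _ = refl
... | no i≢i = ⊥-elim (i≢i refl)

transpose-≡ʳ : ∀ i j → transpose i j j ≡ i
transpose-≡ʳ i j with j ≟ i | j ≟ j
... | yes j≡i | _ = j≡i
... | no _ | yes _ = refl
... | no _ | no j≢j = ⊥-elim (j≢j refl)

transpose-≢ : ∀ {i j k} → k ≢ i → k ≢ j → transpose i j k ≡ k
transpose-≢ {i} {j} {k} k≢i k≢j with k ≟ i | k ≟ j
... | yes k≡i | _ = ⊥-elim (k≢i k≡i)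
... | no _ | yes k≡j = ⊥-elim (k≢j k≡j)
... | no _ | no _ = refl

transpose-involutive : ∀ i j k → transpose i j (transpose i j k) ≡ k
transpose-involutive i j k with k ≟ i | k ≟ j
... | yes refl | _ = transpose-≡ʳ k j
... | no _ | yes refl = transpose-≡ˡ i k
... | no k≢i | no k≢j = transpose-≢ k≢i k≢j

transpose-≤ʳ : ∀ i j {k} → (k ≢ i → k < j) → transpose i j k ≤ j
transpose-≤ʳ i j {k} k<j with k ≟ i | k ≟ j
... | yes _ | _ = ≤-refl
... | no k≢i | yes refl = ⊥-elim (<-irrefl refl (k<j k≢i))
... | no k≢i | no _ = <⇒≤ (k<j k≢i)

transposition : ℕ → ℕ → Perm
transposition i j = record
  { fun = transpose i j ; inv = transpose i j
  ; inv-fun = transpose-involutive i j ; fun-inv = transpose-involutive i j }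

idₚ : Perm
idₚ = record { fun = λ k → k ; inv = λ k → k ; inv-fun = λ _ → refl ; fun-inv = λ _ → refl }

infixr 9 _∘ₚ_
_∘ₚ_ : Perm → Perm → Perm
σ ∘ₚ τ = record
  { fun = λ k → fun σ (fun τ k)
  ; inv = λ k → inv τ (inv σ k)
  ; inv-fun = λ k → trans (cong (inv τ) (inv-fun σ (fun τ k))) (inv-fun τ k)
  ; fun-inv = λ k → trans (cong (fun σ) (fun-inv τ (inv σ k))) (fun-inv σ k) }

_⁻¹ₚ : Perm → Perm
σ ⁻¹ₚ = record { fun = inv σ ; inv = fun σ ; inv-fun = fun-inv σ ; fun-inv = inv-fun σ }

fun-injective : ∀ σ {i j} → fun σ i ≡ fun σ j → i ≡ j
fun-injective σ {i} {j} eq = trans (sym (inv-fun σ i)) (trans (cong (inv σ) eq) (inv-fun σ j))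

fun≡⇒inv≡ : ∀ σ {i j} → fun σ i ≡ j → inv σ j ≡ i
fun≡⇒inv≡ σ {i} refl = inv-fun σ i

InSymN-mono : ∀ {m n σ} → m ≤ n → InSymN m σ → InSymN n σ
InSymN-mono m≤n σ∈Sym i n≤i = σ∈Sym i (≤-trans m≤n n≤i)

InSymN-id : ∀ n → InSymN n idₚ
InSymN-id n i _ = refl

InSymN-∘ : ∀ {n σ τ} → InSymN n σ → InSymN n τ → InSymN n (σ ∘ₚ τ)
InSymN-∘ {σ = σ} σ∈Sym τ∈Sym i n≤i = trans (cong (fun σ) (τ∈Sym i n≤i)) (σ∈Sym i n≤i)

InSymN-inv-fixes : ∀ {n σ} → InSymN n σ → ∀ i → n ≤ i → inv σ i ≡ i
InSymN-inv-fixes {σ = σ} σ∈Sym i n≤i = fun≡⇒inv≡ σ (σ∈Sym i n≤i)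

InSymN-⁻¹ : ∀ {n σ} → InSymN n σ → InSymN n (σ ⁻¹ₚ)
InSymN-⁻¹ {σ = σ} = InSymN-inv-fixes {σ = σ}

InSymN-transposition : ∀ {n} i j → i < n → j < n → InSymN n (transposition i j)
InSymN-transposition {n} i j i<n j<n k n≤k =
  transpose-≢ (λ { refl → <⇒≱ i<n n≤k }) (λ { refl → <⇒≱ j<n n≤k })

InSymN-fun-< : ∀ {n σ} → InSymN n σ → ∀ {k} → k < n → fun σ k < n
InSymN-fun-< {n} {σ} σ∈Sym {k} k<n with fun σ k <? n
... | yes σk<n = σk<n
... | no σk≮n =
  ⊥-elim (<⇒≱ k<n (subst (n ≤_) (fun-injective σ (σ∈Sym _ (≮⇒≥ σk≮n))) (≮⇒≥ σk≮n)))

InjectiveBelow : ℕ → (ℕ → ℕ) → Set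
InjectiveBelow k t = ∀ {i j} → i < k → j < k → t i ≡ t j → i ≡ j

realise : (ℕ → ℕ) → ℕ → Perm
realise t zero = idₚ
realise t (suc k) = transposition (fun (realise t k) k) (t k) ∘ₚ realise t k

-- Step k only moves the current image of k and the value t k, and neither is the image of
-- an earlier position when t is injective.
realise-spec : ∀ t k → InjectiveBelow k t → ∀ {i} → i < k → fun (realise t k) i ≡ t i
realise-spec t (suc k) t-inj {i} i<1+k with i ≟ k
... | yes refl = transpose-≡ˡ (fun (realise t i) i) (t i)
... | no i≢k = trans (cong (transpose (fun (realise t k) k) (t k)) ρi≡ti)
                  (transpose-≢ (λ eq → i≢k (fun-injective (realise t k) (trans ρi≡ti eq)))
                               (λ eq → i≢k (t-inj i<1+k ≤-refl eq)))
  where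
  ρi≡ti : fun (realise t k) i ≡ t i
  ρi≡ti = realise-spec t k (λ i<k j<k → t-inj (m<n⇒m<1+n i<k) (m<n⇒m<1+n j<k))
                           (≤∧≢⇒< (≤-pred i<1+k) i≢k)

realise-InSym : ∀ t k → InSym (realise t k)
realise-InSym t zero = 0 , InSymN-id 0
realise-InSym t (suc k) with realise-InSym t k
... | B , ρ∈Sym = B ⊔ bound , InSymN-∘ {σ = transposition a (t k)} {τ = realise t k}
  (InSymN-mono {σ = transposition a (t k)} (m≤n⊔m B bound) (InSymN-transposition a (t k) a<bound tk<bound))
  (InSymN-mono {σ = realise t k} (m≤m⊔n B bound) ρ∈Sym)
  where
  a bound : ℕ
  a = fun (realise t k) k
  bound = suc (a ⊔ t k)
  a<bound : a < bound
  a<bound = s≤s (m≤m⊔n a (t k))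
  tk<bound : t k < bound
  tk<bound = s≤s (m≤n⊔m a (t k))

-- Each step swaps the image of the new index into position length I, which is still < n.
gather-into-prefix : ∀ (I : List ℕ) n → length I ≤ n →
  ∃[ σ ] (InSymN n σ × (∀ {x} → x ∈ I → x < n → fun σ x < length I))
gather-into-prefix [] n _ = idₚ , InSymN-id n , λ ()
gather-into-prefix (x ∷ I) n |xI|≤n with gather-into-prefix I n (<⇒≤ |xI|≤n) | x <? n
... | σ , σ∈Sym , σI<|I| | no x≮n = σ , σ∈Sym , prefix
  where
  prefix : ∀ {y} → y ∈ x ∷ I → y < n → fun σ y < suc (length I)
  prefix (here refl) y<n = ⊥-elim (x≮n y<n)
  prefix (there y∈I) y<n = m<n⇒m<1+n (σI<|I| y∈I y<n)
... | σ , σ∈Sym , σI<|I| | yes x<n =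
  τ ∘ₚ σ , InSymN-∘ {σ = τ} {τ = σ}
    (InSymN-transposition (fun σ x) (length I) (InSymN-fun-< {σ = σ} σ∈Sym x<n) |xI|≤n) σ∈Sym , prefix
  where
  τ : Perm
  τ = transposition (fun σ x) (length I)
  prefix : ∀ {y} → y ∈ x ∷ I → y < n → fun τ (fun σ y) < suc (length I)
  prefix (here refl) _ = s≤s (transpose-≤ʳ (fun σ x) (length I) λ x≢x → ⊥-elim (x≢x refl))
  prefix (there y∈I) y<n = s≤s (transpose-≤ʳ (fun σ x) (length I) λ _ → σI<|I| y∈I y<n)

infixr 5 _◃_
_◃_ : ℕ → (ℕ → ℕ) → ℕ → ℕ
(x ◃ f) zero = x
(x ◃ f) (suc i) = f i

-- Maps {0,…,k-1} → {0,…,M-1}, as functions on ℕ whose values at i ≥ k are irrelevant.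
boundedMaps : ℕ → ℕ → List (ℕ → ℕ)
boundedMaps zero M = (λ _ → 0) ∷ []
boundedMaps (suc k) M = concatMap (λ x → map (x ◃_) (boundedMaps k M)) (upTo M)

boundedMaps-complete : ∀ k M g → (∀ {i} → i < k → g i < M) →
  Any (λ f → ∀ {i} → i < k → f i ≡ g i) (boundedMaps k M)
boundedMaps-complete zero M g _ = here λ ()
boundedMaps-complete (suc k) M g g<M =
  Any.concatMap⁺ _ (Any.map (λ { refl → Any.map⁺ (Any.map extend rest) }) (∈-upTo⁺ (g<M (s≤s z≤n))))
  where
  rest : Any (λ f → ∀ {i} → i < k → f i ≡ g (suc i)) (boundedMaps k M)
  rest = boundedMaps-complete k M (λ i → g (suc i)) (λ i<k → g<M (s≤s i<k))
  extend : ∀ {f} → (∀ {i} → i < k → f i ≡ g (suc i)) → ∀ {i} → i < suc k → (g 0 ◃ f) i ≡ g i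
  extend f≡g {zero} _ = refl
  extend f≡g {suc i} (s≤s i<k) = f≡g i<k

module OrderedFieldProperties (ℝ : RealField) where
  open RealField ℝ

  commutativeRing : CommutativeRing 0ℓ 0ℓ
  commutativeRing = record { isCommutativeRing = isCommutativeRing }

  open CommutativeRing commutativeRing public
    using (+-assoc; +-comm; +-identityˡ; +-identityʳ; -‿inverseˡ; -‿inverseʳ;
           *-assoc; *-identityˡ; distribˡ; zeroˡ; zeroʳ; *-comm)
  open RingProperties (CommutativeRing.ring commutativeRing) using (-1*x≈-x; -‿involutive; -0#≈0#)
  open GroupProperties (CommutativeRing.+-group commutativeRing) using (//-rightDividesˡ; //-rightDividesʳ)
  open RS.IsTotalOrder isTotalOrder public using (total; antisym) renaming (refl to ≤ᵣ-refl; trans to ≤ᵣ-trans)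

  +-monoˡ : ∀ {x y} z → x ≤ᵣ y → z + x ≤ᵣ z + y
  +-monoˡ {x} {y} z x≤y = subst₂ _≤ᵣ_ (+-comm x z) (+-comm y z) (+-mono z x≤y)

  +-cancelʳ-≤ : ∀ {x y} z → x + z ≤ᵣ y + z → x ≤ᵣ y
  +-cancelʳ-≤ {x} {y} z le = subst₂ _≤ᵣ_ (//-rightDividesʳ z x) (//-rightDividesʳ z y) (+-mono (- z) le)

  x≤x+y : ∀ x {y} → 0# ≤ᵣ y → x ≤ᵣ x + y
  x≤x+y x 0≤y = subst (_≤ᵣ x + _) (+-identityʳ x) (+-monoˡ x 0≤y)

  +-nonneg : ∀ {x y} → 0# ≤ᵣ x → 0# ≤ᵣ y → 0# ≤ᵣ x + y
  +-nonneg {x} 0≤x 0≤y = ≤ᵣ-trans 0≤x (x≤x+y x 0≤y)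

  0≤1 : 0# ≤ᵣ 1#
  0≤1 with total 0# 1#
  ... | inj₁ le = le
  ... | inj₂ 1≤0 = subst (0# ≤ᵣ_) (trans (-1*x≈-x (- 1#)) (-‿involutive 1#)) (*-nonneg 0≤-1 0≤-1)
    where
    0≤-1 : 0# ≤ᵣ - 1#
    0≤-1 = subst₂ _≤ᵣ_ (-‿inverseʳ 1#) (+-identityˡ (- 1#)) (+-mono (- 1#) 1≤0)

  1≰0 : ¬ (1# ≤ᵣ 0#)
  1≰0 1≤0 = 0≢1 (antisym 0≤1 1≤0)

  nonneg-sum-zeroˡ : ∀ {x y} → 0# ≤ᵣ x → 0# ≤ᵣ y → x + y ≡ 0# → x ≡ 0#
  nonneg-sum-zeroˡ {x} 0≤x 0≤y x+y≡0 = antisym (subst (x ≤ᵣ_) x+y≡0 (x≤x+y x 0≤y)) 0≤x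

  nonneg-sum-zeroʳ : ∀ {x y} → 0# ≤ᵣ x → 0# ≤ᵣ y → x + y ≡ 0# → y ≡ 0#
  nonneg-sum-zeroʳ {x} {y} 0≤x 0≤y x+y≡0 = nonneg-sum-zeroˡ 0≤y 0≤x (trans (+-comm y x) x+y≡0)

  -- The supremum of {0} ∪ {2 ∣ P} lies on one side of 1, and either side decides ¬ P or ¬ ¬ P.
  weak-excluded-middle : (P : Set) → ¬ P ⊎ ¬ ¬ P
  weak-excluded-middle P with complete S (0# , inj₁ refl) (1# + 1# , S≤2)
    where
    S : Carrier → Set
    S y = y ≡ 0# ⊎ (y ≡ 1# + 1# × P)
    S≤2 : ∀ y → S y → y ≤ᵣ 1# + 1#
    S≤2 _ (inj₁ refl) = +-nonneg 0≤1 0≤1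
    S≤2 _ (inj₂ (refl , _)) = ≤ᵣ-refl
  ... | s , S≤s , s-least with total s 1#
  ...   | inj₁ s≤1 = inj₁ λ p →
            1≰0 (+-cancelʳ-≤ 1# (subst (1# + 1# ≤ᵣ_) (sym (+-identityˡ 1#))
                                      (≤ᵣ-trans (S≤s _ (inj₂ (refl , p))) s≤1)))
  ...   | inj₂ 1≤s = inj₂ λ ¬p → 1≰0 (≤ᵣ-trans 1≤s (s-least 0# λ
            { _ (inj₁ refl) → ≤ᵣ-refl
            ; _ (inj₂ (_ , p)) → ⊥-elim (¬p p) }))

  -- S = {y ∣ ¬ ¬ y ≡ 0} is closed under y ↦ x + y, so its supremum s satisfies s ≤ s - x.
  ¬¬≡0⇒≤0 : ∀ x → ¬ ¬ (x ≡ 0#) → x ≤ᵣ 0#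
  ¬¬≡0⇒≤0 x ¬¬x≡0 with complete S (0# , λ k → k refl) (1# , S≤1)
    where
    S : Carrier → Set
    S y = ¬ ¬ (y ≡ 0#)
    S≤1 : ∀ y → S y → y ≤ᵣ 1#
    S≤1 y ¬¬y≡0 with total y 1#
    ... | inj₁ y≤1 = y≤1
    ... | inj₂ 1≤y = ⊥-elim (¬¬y≡0 λ y≡0 → 1≰0 (subst (1# ≤ᵣ_) y≡0 1≤y))
  ... | s , S≤s , s-least = +-cancelʳ-≤ s (subst₂ _≤ᵣ_ (+-comm s x) (sym (+-identityˡ s)) s+x≤s)
    where
    x+S⊆S : ∀ y → ¬ ¬ (y ≡ 0#) → ¬ ¬ (x + y ≡ 0#)
    x+S⊆S y ¬¬y≡0 k =
      ¬¬x≡0 λ x≡0 → ¬¬y≡0 λ y≡0 → k (trans (cong₂ _+_ x≡0 y≡0) (+-identityˡ 0#))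
    s≤s-x : s ≤ᵣ s + - x
    s≤s-x = s-least (s + - x) λ y y∈S →
      subst₂ _≤ᵣ_ (trans (cong (_+ - x) (+-comm x y)) (//-rightDividesʳ x y)) refl
        (+-mono (- x) (S≤s (x + y) (x+S⊆S y y∈S)))
    s+x≤s : s + x ≤ᵣ s
    s+x≤s = subst (s + x ≤ᵣ_) (//-rightDividesˡ x s) (+-mono x s≤s-x)

  ≡0-stable : ∀ x → ¬ ¬ (x ≡ 0#) → x ≡ 0#
  ≡0-stable x ¬¬x≡0 = antisym (¬¬≡0⇒≤0 x ¬¬x≡0) 0≤x
    where
    -x≤0 : - x ≤ᵣ 0#
    -x≤0 = ¬¬≡0⇒≤0 (- x) λ k → ¬¬x≡0 λ x≡0 → k (trans (cong -_ x≡0) -0#≈0#)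
    0≤x : 0# ≤ᵣ x
    0≤x = subst₂ _≤ᵣ_ (-‿inverseˡ x) (+-identityˡ x) (+-mono x -x≤0)

  _≟0 : ∀ x → Dec (x ≡ 0#)
  x ≟0 = [ no , (λ ¬¬x≡0 → yes (≡0-stable x ¬¬x≡0)) ]′ (weak-excluded-middle (x ≡ 0#))

  ≢0∧*≡0⇒≡0 : ∀ {c v} → ¬ (c ≡ 0#) → c * v ≡ 0# → v ≡ 0#
  ≢0∧*≡0⇒≡0 {c} {v} c≢0 cv≡0 with inverse c c≢0
  ... | c⁻¹ , cc⁻¹≡1 = begin
      v                ≡⟨ sym (*-identityˡ v) ⟩
      1# * v           ≡⟨ cong (_* v) (sym (trans (*-comm c⁻¹ c) cc⁻¹≡1)) ⟩
      (c⁻¹ * c) * v    ≡⟨ *-assoc c⁻¹ c v ⟩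
      c⁻¹ * (c * v)    ≡⟨ cong (c⁻¹ *_) cv≡0 ⟩
      c⁻¹ * 0#         ≡⟨ zeroʳ c⁻¹ ⟩
      0#               ∎
    where open ≡-Reasoning

module ConeProperties (ℝ : RealField) where
  open RealField ℝ
  open WithReals ℝ
  open OrderedFieldProperties ℝ

  infix 4 _⊆_
  _⊆_ : Subset → Subset → Set
  A ⊆ B = ∀ {u} → A u → B u

  WeightedIn : Subset → Carrier × Seq → Set
  WeightedIn A (c , v) = 0# ≤ᵣ c × A v

  ≐-sym : ∀ {u v} → u ≐ v → v ≐ u
  ≐-sym u≐v i = sym (u≐v i)

  ≐-trans : ∀ {u v w} → u ≐ v → v ≐ w → u ≐ w
  ≐-trans u≐v v≐w i = trans (u≐v i) (v≐w i)

  lincomb-++ : ∀ xs ys → lincomb (xs ++ ys) ≐ (lincomb xs ⊕ lincomb ys)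
  lincomb-++ [] ys i = sym (+-identityˡ _)
  lincomb-++ ((c , v) ∷ xs) ys i = trans (cong (c * v i +_) (lincomb-++ xs ys i)) (sym (+-assoc _ _ _))

  lincomb-scale : ∀ d xs → lincomb (map (map₁ (d *_)) xs) ≐ (d · lincomb xs)
  lincomb-scale d [] i = sym (zeroʳ d)
  lincomb-scale d ((c , v) ∷ xs) i =
    trans (cong₂ _+_ (*-assoc d c (v i)) (lincomb-scale d xs i)) (sym (distribˡ d _ _))

  lincomb-act : ∀ σ xs → lincomb (map (map₂ (act σ)) xs) ≐ act σ (lincomb xs)
  lincomb-act σ [] i = refl
  lincomb-act σ ((c , v) ∷ xs) i = cong (c * v (inv σ i) +_) (lincomb-act σ xs i)

  lincomb-nonneg : ∀ {A} → (∀ {v} → A v → Nonneg v) → ∀ {xs} → All (WeightedIn A) xs → Nonneg (lincomb xs)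
  lincomb-nonneg A≥0 [] i = ≤ᵣ-refl
  lincomb-nonneg A≥0 ((0≤c , Av) ∷ ws) i = +-nonneg (*-nonneg 0≤c (A≥0 Av i)) (lincomb-nonneg A≥0 ws i)

  cn-IsSet : ∀ {A} → IsSet (cn A)
  cn-IsSet u≐v (xs , ws , u≐xs) = xs , ws , ≐-trans (≐-sym u≐v) u≐xs

  cn-IsCone : ∀ {A} → IsCone (cn A)
  cn-IsCone = ([] , [] , λ _ → refl)
    , (λ { (xs , ws , u≐xs) (ys , ws′ , v≐ys) → xs ++ ys , All.++⁺ ws ws′ ,
           λ i → trans (cong₂ _+_ (u≐xs i) (v≐ys i)) (sym (lincomb-++ xs ys i)) })
    , (λ { {c} 0≤c (xs , ws , u≐xs) → map (map₁ (c *_)) xs ,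
           All.map⁺ (All.map (λ { (0≤d , Av) → *-nonneg 0≤c 0≤d , Av }) ws) ,
           λ i → trans (cong (c *_) (u≐xs i)) (sym (lincomb-scale c xs i)) })

  ⊆-cn : ∀ {A} → A ⊆ cn A
  ⊆-cn {u = v} Av = (1# , v) ∷ [] , (0≤1 , Av) ∷ [] , λ i → sym (trans (+-identityʳ _) (*-identityˡ (v i)))

  cn-least : ∀ {A D} → IsSet D → IsCone D → A ⊆ D → cn A ⊆ D
  cn-least {A} {D} D-set (D0 , D+ , D·) A⊆D (xs , ws , u≐xs) = D-set (≐-sym u≐xs) (combination ws)
    where
    combination : ∀ {xs} → All (WeightedIn A) xs → D (lincomb xs)
    combination [] = D0
    combination ((0≤c , Av) ∷ ws) = D+ (D· 0≤c (A⊆D Av)) (combination ws)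

  ⊆cn⇒cn⊆ : ∀ {A B} → A ⊆ cn B → cn A ⊆ cn B
  ⊆cn⇒cn⊆ = cn-least cn-IsSet cn-IsCone

  cn-act : ∀ {A B} σ → (∀ {a} → A a → B (act σ a)) → ∀ {u} → cn A u → cn B (act σ u)
  cn-act σ σA⊆B (xs , ws , u≐xs) = map (map₂ (act σ)) xs ,
    All.map⁺ (All.map (map₂ σA⊆B) ws) , λ i → trans (u≐xs (inv σ i)) (sym (lincomb-act σ xs i))

  InRn-⊕⁻ : ∀ {n u v} → Nonneg u → Nonneg v → InRn n (u ⊕ v) → InRn n u × InRn n v
  InRn-⊕⁻ u≥0 v≥0 u+v∈ℝⁿ = (λ i n≤i → nonneg-sum-zeroˡ (u≥0 i) (v≥0 i) (u+v∈ℝⁿ i n≤i))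
                         , (λ i n≤i → nonneg-sum-zeroʳ (u≥0 i) (v≥0 i) (u+v∈ℝⁿ i n≤i))

  InRn-·⁻ : ∀ {n c v} → ¬ c ≡ 0# → InRn n (c · v) → InRn n v
  InRn-·⁻ c≢0 cv∈ℝⁿ i n≤i = ≢0∧*≡0⇒≡0 c≢0 (cv∈ℝⁿ i n≤i)

  -- Nonnegative terms cannot cancel, so a term with nonzero coefficient already lies in ℝⁿ.
  cn-restrict : ∀ {A n} → (∀ {v} → A v → Nonneg v) → ∀ {u} → cn A u → InRn n u →
                cn (λ v → A v × InRn n v) u
  cn-restrict {A} {n} A≥0 (xs , ws , u≐xs) u∈ℝⁿ
    with restrict ws (λ i n≤i → trans (sym (u≐xs i)) (u∈ℝⁿ i n≤i))
    where
    restrict : ∀ {xs} → All (WeightedIn A) xs → InRn n (lincomb xs) →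
               ∃[ ys ] (All (WeightedIn (λ v → A v × InRn n v)) ys × lincomb xs ≐ lincomb ys)
    restrict [] _ = [] , [] , λ _ → refl
    restrict {(c , v) ∷ xs} ((0≤c , Av) ∷ ws) ∈ℝⁿ
      with InRn-⊕⁻ (λ i → *-nonneg 0≤c (A≥0 Av i)) (lincomb-nonneg A≥0 ws) ∈ℝⁿ | c ≟0
    ... | _ , rest∈ℝⁿ | yes c≡0 = let ys , ws′ , xs≐ys = restrict ws rest∈ℝⁿ in ys , ws′ ,
          λ i → trans (cong (_+ lincomb xs i) (trans (cong (_* v i) c≡0) (zeroˡ (v i))))
                      (trans (+-identityˡ _) (xs≐ys i))
    ... | cv∈ℝⁿ , rest∈ℝⁿ | no c≢0 = let ys , ws′ , xs≐ys = restrict ws rest∈ℝⁿ in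
          (c , v) ∷ ys , (0≤c , Av , InRn-·⁻ c≢0 cv∈ℝⁿ) ∷ ws′ , λ i → cong (c * v i +_) (xs≐ys i)
  ... | ys , ws′ , xs≐ys = ys , ws′ , ≐-trans u≐xs xs≐ys

  act-⁻¹ : ∀ σ v → act (σ ⁻¹ₚ) (act σ v) ≐ v
  act-⁻¹ σ v i = cong v (inv-fun σ i)

  act-cong-support : ∀ {a ρ π} → (∀ {j} → ¬ a j ≡ 0# → fun ρ j ≡ fun π j) → act ρ a ≐ act π a
  act-cong-support {a} {ρ} {π} agree i with a (inv ρ i) ≟0 | a (inv π i) ≟0
  ... | yes aρ≡0 | yes aπ≡0 = trans aρ≡0 (sym aπ≡0)
  ... | no aρ≢0 | _ = cong a (sym (fun≡⇒inv≡ π (trans (sym (agree aρ≢0)) (fun-inv ρ i))))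
  ... | yes _ | no aπ≢0 = cong a (fun≡⇒inv≡ ρ (trans (agree aπ≢0) (fun-inv π i)))

  act-InRn : ∀ {N n a} σ → InRn N a → (∀ {j} → j < N → a j ≡ 0# ⊎ fun σ j < n) → InRn n (act σ a)
  act-InRn {N} {n} {a} σ a∈ℝᴺ fits i n≤i with inv σ i <? N
  ... | no σ⁻¹i≮N = a∈ℝᴺ _ (≮⇒≥ σ⁻¹i≮N)
  ... | yes σ⁻¹i<N with fits σ⁻¹i<N
  ...   | inj₁ a≡0 = a≡0
  ...   | inj₂ σσ⁻¹i<n = ⊥-elim (<⇒≱ (subst (_< n) (fun-inv σ i) σσ⁻¹i<n) n≤i)

  act-InSymN-InRn : ∀ {n a σ} → InSymN n σ → InRn n a → InRn n (act σ a)
  act-InSymN-InRn {a = a} {σ} σ∈Sym a∈ℝⁿ i n≤i =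
    trans (cong a (InSymN-inv-fixes {σ = σ} σ∈Sym i n≤i)) (a∈ℝⁿ i n≤i)

  act-SuppAtMost : ∀ {N a} σ → InRn N a → SuppAtMost N (act σ a)
  act-SuppAtMost {N} {a} σ a∈ℝᴺ = applyUpTo (fun σ) N , ≤-reflexive (length-applyUpTo (fun σ) N) , support
    where
    support : ∀ i → ¬ a (inv σ i) ≡ 0# → i ∈ applyUpTo (fun σ) N
    support i a≢0 with inv σ i <? N
    ... | yes σ⁻¹i<N = subst (_∈ applyUpTo (fun σ) N) (fun-inv σ i) (∈-applyUpTo⁺ (fun σ) σ⁻¹i<N)
    ... | no σ⁻¹i≮N = ⊥-elim (a≢0 (a∈ℝᴺ _ (≮⇒≥ σ⁻¹i≮N)))

  SuppAtMost-IsSet : ∀ {s} → IsSet (SuppAtMost s)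
  SuppAtMost-IsSet u≐v (I , |I|≤s , supp⊆I) =
    I , |I|≤s , λ i vi≢0 → supp⊆I i λ ui≡0 → vi≢0 (trans (sym (u≐v i)) ui≡0)

  move-into-prefix : ∀ {s m n v} → InRn n v → SuppAtMost s v → s ≤ m → m ≤ n →
                     ∃[ σ ] (InSymN n σ × InRn m (act σ v))
  move-into-prefix {s} {m} {n} {v} v∈ℝⁿ (I , |I|≤s , supp⊆I) s≤m m≤n
    with gather-into-prefix I n (≤-trans |I|≤s (≤-trans s≤m m≤n))
  ... | σ , σ∈Sym , σI<|I| = σ , σ∈Sym , act-InRn σ v∈ℝⁿ fits
    where
    fits : ∀ {j} → j < n → v j ≡ 0# ⊎ fun σ j < m
    fits {j} j<n with v j ≟0
    ... | yes vj≡0 = inj₁ vj≡0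
    ... | no vj≢0 = inj₂ (<-≤-trans (σI<|I| (supp⊆I j vj≢0) j<n) (≤-trans |I|≤s s≤m))

  InRn-mono : ∀ {m n u} → m ≤ n → InRn m u → InRn n u
  InRn-mono m≤n u∈ℝᵐ i n≤i = u∈ℝᵐ i (≤-trans m≤n n≤i)

  Cbar-IsSet : ∀ {C} → IsSet C → ∀ n → IsSet (Cbar C n)
  Cbar-IsSet C-set n u≐v (Cu , u∈ℝⁿ) = C-set u≐v Cu , λ i n≤i → trans (sym (u≐v i)) (u∈ℝⁿ i n≤i)

  Cbar-IsCone : ∀ {C} → IsCone C → ∀ n → IsCone (Cbar C n)
  Cbar-IsCone (C0 , C+ , C·) n = (C0 , λ _ _ → refl)
    , (λ { (Cu , u∈ℝⁿ) (Cv , v∈ℝⁿ) → C+ Cu Cv ,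
           λ i n≤i → trans (cong₂ _+_ (u∈ℝⁿ i n≤i) (v∈ℝⁿ i n≤i)) (+-identityˡ 0#) })
    , (λ { {c} 0≤c (Cu , u∈ℝⁿ) → C· 0≤c Cu ,
           λ i n≤i → trans (cong (c *_) (u∈ℝⁿ i n≤i)) (zeroʳ c) })

  ofList-⊆ : ∀ {P L} → IsSet P → All P L → ofList L ⊆ P
  ofList-⊆ P-set PL v∈L with All.lookupAny PL v∈L
  ... | Pg , v≐g = P-set (≐-sym v≐g) Pg

  ∈⇒ofList : ∀ {a L} → a ∈ L → ofList L a
  ∈⇒ofList = Any.map λ { refl _ → refl }

  ofList⊆SymOrb : ∀ {A} → ofList A ⊆ SymOrb (ofList A)
  ofList⊆SymOrb a∈A = idₚ , (0 , InSymN-id 0) , _ , a∈A , λ _ → refl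

  InR∞-bound : ∀ {L} → All InR∞ L → ∃[ N ] All (InRn N) L
  InR∞-bound [] = 0 , []
  InR∞-bound ((Na , a∈ℝᴺᵃ) ∷ L∈ℝ∞) with InR∞-bound L∈ℝ∞
  ... | N , L∈ℝᴺ =
    Na ⊔ N , InRn-mono (m≤m⊔n Na N) a∈ℝᴺᵃ ∷ All.map (InRn-mono (m≤n⊔m Na N)) L∈ℝᴺ

module Equivalences (ℝ : RealField) (C : WithReals.Subset ℝ) (C-set : WithReals.IsSet ℝ C)
  (C-pos : ∀ u → C u → WithReals.InR∞ ℝ u × WithReals.Nonneg ℝ u)
  (C-cone : WithReals.IsCone ℝ C) (C-inv : WithReals.SymInvariant ℝ C) where
  open import Data.Nat using (_+_)
  open RealField ℝ using (0#)
  open WithReals ℝ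
  open OrderedFieldProperties ℝ
  open ConeProperties ℝ
  open Equivalence

  stable⇒EqFinGen : Stabilizes (Cbar C) → (∀ n → 1 ≤ n → FinGen (Cbar C n)) → EqFinGen C
  stable⇒EqFinGen (r , stab) fingen with fingen (suc r) (s≤s z≤n)
  ... | A , C̄ₘ≋A = A , λ u → mk⇔ C⊆cnSymA (cn-least C-set C-cone SymA⊆C)
    where
    m : ℕ
    m = suc r
    SymA⊆C : SymOrb (ofList A) ⊆ C
    SymA⊆C (σ , σ∈Sym , a , a∈A , v≐σa) =
      C-set (≐-sym v≐σa) (C-inv σ σ∈Sym (proj₁ (from (C̄ₘ≋A a) (⊆-cn a∈A))))
    SymₙC̄ₘ⊆cnSymA : ∀ {n} → SymNOrb n (Cbar C m) ⊆ cn (SymOrb (ofList A))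
    SymₙC̄ₘ⊆cnSymA {n} (σ , σ∈Symₙ , a , a∈C̄ₘ , v≐σa) = cn-IsSet (≐-sym v≐σa)
      (cn-act σ (λ b∈A → σ , (n , σ∈Symₙ) , _ , b∈A , λ _ → refl) (to (C̄ₘ≋A a) a∈C̄ₘ))
    C⊆cnSymA : ∀ {u} → C u → cn (SymOrb (ofList A)) u
    C⊆cnSymA {u} Cu with proj₁ (C-pos u Cu)
    ... | N , u∈ℝᴺ = ⊆cn⇒cn⊆ SymₙC̄ₘ⊆cnSymA
      (to (stab m (N + m) (s≤s z≤n) (n≤1+n r) (m≤n+m m N) u) (Cu , InRn-mono (m≤m+n N m) u∈ℝᴺ))

  BoundedSupportGen⇒stable : BoundedSupportGen C → Stabilizes (Cbar C) × (∀ n → 1 ≤ n → FinGen (Cbar C n))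
  BoundedSupportGen⇒stable (s , gens) =
    (suc s , stab) , λ n 1≤n → let G , _ , C̄ₙ≋G = gens n 1≤n in G , C̄ₙ≋G
    where
    stab : ∀ m n → 1 ≤ m → suc s ≤ m → m ≤ n → Cbar C n ≋ cn (SymNOrb n (Cbar C m))
    stab m n 1≤m s<m m≤n with gens n (≤-trans 1≤m m≤n)
    ... | G , G-supp , C̄ₙ≋G = λ u → mk⇔ (λ u∈C̄ₙ → ⊆cn⇒cn⊆ G⊆ (to (C̄ₙ≋G u) u∈C̄ₙ))
                                          (cn-least (Cbar-IsSet C-set n) (Cbar-IsCone C-cone n) SymₙC̄ₘ⊆C̄ₙ)
      where
      SymₙC̄ₘ⊆C̄ₙ : SymNOrb n (Cbar C m) ⊆ Cbar C n
      SymₙC̄ₘ⊆C̄ₙ (σ , σ∈Symₙ , a , (Ca , a∈ℝᵐ) , v≐σa) = Cbar-IsSet C-set n (≐-sym v≐σa)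
        (C-inv σ (n , σ∈Symₙ) Ca , act-InSymN-InRn {σ = σ} σ∈Symₙ (InRn-mono m≤n a∈ℝᵐ))
      G⊆ : ofList G ⊆ cn (SymNOrb n (Cbar C m))
      G⊆ {v} v∈G with from (C̄ₙ≋G v) (⊆-cn v∈G)
      ... | Cv , v∈ℝⁿ with move-into-prefix v∈ℝⁿ (ofList-⊆ SuppAtMost-IsSet G-supp v∈G) (<⇒≤ s<m) m≤n
      ...   | σ , σ∈Symₙ , σv∈ℝᵐ = ⊆-cn (σ ⁻¹ₚ , InSymN-⁻¹ {σ = σ} σ∈Symₙ , act σ v ,
                                        (C-inv σ (n , σ∈Symₙ) Cv , σv∈ℝᵐ) , ≐-sym (act-⁻¹ σ v))

  generators⊆C : ∀ {A} → C ≋ cn (SymOrb (ofList A)) → All C A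
  generators⊆C C≋A = All.tabulate λ a∈A → from (C≋A _) (⊆-cn (ofList⊆SymOrb (∈⇒ofList a∈A)))

  -- Generators of C̄ₙ: the translates of the generators a ∈ A ⊆ ℝᴺ by the permutations realising maps
  -- {0,…,N-1} → {0,…,n+N-1}, kept when they land in ℝⁿ.
  module Placements {A} (C≋A : C ≋ cn (SymOrb (ofList A))) (N : ℕ) (A⊆ℝᴺ : All (InRn N) A) (n : ℕ) where
    placement : (ℕ → ℕ) → Perm
    placement f = realise f N

    Fits : Seq → (ℕ → ℕ) → Set
    Fits a f = ∀ {j} → j < N → a j ≡ 0# ⊎ fun (placement f) j < n

    fits? : ∀ a f → Dec (Fits a f)
    fits? a f = allUpTo? (λ j → (a j ≟0) ⊎-dec (fun (placement f) j <? n)) N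

    translates : Seq → List Seq
    translates a = map (λ f → act (placement f) a) (filter (fits? a) (boundedMaps N (n + N)))

    generators : List Seq
    generators = concatMap translates A

    generators-sound : All (λ g → Cbar C n g × SuppAtMost N g) generators
    generators-sound = All.concat⁺ (All.map⁺ (All.map translates-sound (All.zip (generators⊆C C≋A , A⊆ℝᴺ))))
      where
      translates-sound : ∀ {a} → C a × InRn N a → All (λ g → Cbar C n g × SuppAtMost N g) (translates a)
      translates-sound {a} (Ca , a∈ℝᴺ) = All.map⁺ (All.map {P = Fits a}
        (λ {f} fits → (C-inv (placement f) (realise-InSym f N) Ca , act-InRn {n = n} (placement f) a∈ℝᴺ fits)
                     , act-SuppAtMost (placement f) a∈ℝᴺ)
        (All.all-filter (fits? a) (boundedMaps N (n + N))))

    -- σ need not map {0,…,N-1} below n + N; sending each j with σ j ≥ n to the fresh position n + j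
    -- repairs this without changing σ on the support of a when σ a ∈ ℝⁿ.
    redirect : Perm → ℕ → ℕ
    redirect σ j with fun σ j <? n
    ... | yes _ = fun σ j
    ... | no _ = n + j

    redirect-cases : ∀ σ j → (fun σ j < n × redirect σ j ≡ fun σ j)
                           ⊎ (n ≤ fun σ j × redirect σ j ≡ n + j)
    redirect-cases σ j with fun σ j <? n
    ... | yes σj<n = inj₁ (σj<n , refl)
    ... | no σj≮n = inj₂ (≮⇒≥ σj≮n , refl)

    redirect-< : ∀ σ {j} → j < N → redirect σ j < n + N
    redirect-< σ {j} j<N with redirect-cases σ j
    ... | inj₁ (σj<n , r≡σj) = subst (_< n + N) (sym r≡σj) (<-≤-trans σj<n (m≤m+n n N))
    ... | inj₂ (_ , r≡n+j) = subst (_< n + N) (sym r≡n+j) (+-monoʳ-< n j<N)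

    redirect-injective : ∀ σ {i j} → redirect σ i ≡ redirect σ j → i ≡ j
    redirect-injective σ {i} {j} eq with redirect-cases σ i | redirect-cases σ j
    ... | inj₁ (_ , ri) | inj₁ (_ , rj) = fun-injective σ (trans (sym ri) (trans eq rj))
    ... | inj₂ (_ , ri) | inj₂ (_ , rj) = +-cancelˡ-≡ n _ _ (trans (sym ri) (trans eq rj))
    ... | inj₁ (σi<n , ri) | inj₂ (_ , rj) =
      ⊥-elim (<⇒≱ σi<n (subst (n ≤_) (trans (sym rj) (trans (sym eq) ri)) (m≤m+n n j)))
    ... | inj₂ (_ , ri) | inj₁ (σj<n , rj) =
      ⊥-elim (<⇒≱ σj<n (subst (n ≤_) (trans (sym ri) (trans eq rj)) (m≤m+n n i)))

    module _ {a v} (σ : Perm) (a∈ℝᴺ : InRn N a) (v≐σa : v ≐ act σ a) (v∈ℝⁿ : InRn n v) where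
      vanishes-off-ℝⁿ : ∀ {j} → n ≤ fun σ j → a j ≡ 0#
      vanishes-off-ℝⁿ {j} n≤σj =
        trans (cong a (sym (inv-fun σ j))) (trans (sym (v≐σa (fun σ j))) (v∈ℝⁿ _ n≤σj))

      translates-complete : Any (v ≐_) (translates a)
      translates-complete with find (boundedMaps-complete N (n + N) (redirect σ) (redirect-< σ))
      ... | f , f∈maps , f≡redirect =
        Any.map (λ { refl → v≐ρa }) (∈-map⁺ (λ f → act (placement f) a) (∈-filter⁺ (fits? a) f∈maps fits))
        where
        ρ : Perm
        ρ = placement f
        ρ≡redirect : ∀ {j} → j < N → fun ρ j ≡ redirect σ j
        ρ≡redirect j<N = trans (realise-spec f N (λ i<N j<N fi≡fj → redirect-injective σ
          (trans (sym (f≡redirect i<N)) (trans fi≡fj (f≡redirect j<N)))) j<N) (f≡redirect j<N)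
        fits : Fits a f
        fits {j} j<N with redirect-cases σ j
        ... | inj₁ (σj<n , r≡σj) = inj₂ (subst (_< n) (sym (trans (ρ≡redirect j<N) r≡σj)) σj<n)
        ... | inj₂ (n≤σj , _) = inj₁ (vanishes-off-ℝⁿ n≤σj)
        σ≡ρ-on-support : ∀ {j} → ¬ a j ≡ 0# → fun σ j ≡ fun ρ j
        σ≡ρ-on-support {j} aj≢0 with j <? N
        ... | no j≮N = ⊥-elim (aj≢0 (a∈ℝᴺ j (≮⇒≥ j≮N)))
        ... | yes j<N with redirect-cases σ j
        ...   | inj₁ (_ , r≡σj) = sym (trans (ρ≡redirect j<N) r≡σj)
        ...   | inj₂ (n≤σj , _) = ⊥-elim (aj≢0 (vanishes-off-ℝⁿ n≤σj))
        v≐ρa : v ≐ act ρ a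
        v≐ρa = ≐-trans v≐σa (act-cong-support {ρ = σ} {π = ρ} σ≡ρ-on-support)

    SymA∩ℝⁿ⊆generators : ∀ {v} → SymOrb (ofList A) v → InRn n v → ofList generators v
    SymA∩ℝⁿ⊆generators (σ , _ , a′ , a′∈A , v≐σa′) v∈ℝⁿ with find a′∈A
    ... | a , a∈A , a′≐a = Any.concatMap⁺ translates (Any.map
      (λ { refl → translates-complete σ (All.lookup A⊆ℝᴺ a∈A)
                    (λ i → trans (v≐σa′ i) (a′≐a (inv σ i))) v∈ℝⁿ })
      a∈A)

    C̄ₙ≋generators : Cbar C n ≋ cn (ofList generators)
    C̄ₙ≋generators u = mk⇔
      (λ { (Cu , u∈ℝⁿ) → ⊆cn⇒cn⊆ (λ { (v∈SymA , v∈ℝⁿ) → ⊆-cn (SymA∩ℝⁿ⊆generators v∈SymA v∈ℝⁿ) })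
                                  (cn-restrict SymA-nonneg (to (C≋A u) Cu) u∈ℝⁿ) })
      (cn-least (Cbar-IsSet C-set n) (Cbar-IsCone C-cone n)
                (ofList-⊆ (Cbar-IsSet C-set n) (All.map proj₁ generators-sound)))
      where
      SymA-nonneg : ∀ {v} → SymOrb (ofList A) v → Nonneg v
      SymA-nonneg v∈SymA = proj₂ (C-pos _ (from (C≋A _) (⊆-cn v∈SymA)))

  EqFinGen⇒BoundedSupportGen : EqFinGen C → BoundedSupportGen C
  EqFinGen⇒BoundedSupportGen (A , C≋A)
    with InR∞-bound (All.map (λ Ca → proj₁ (C-pos _ Ca)) (generators⊆C C≋A))
  ... | N , A⊆ℝᴺ = N , λ n _ → let open Placements C≋A N A⊆ℝᴺ n in
    generators , All.map proj₂ generators-sound , C̄ₙ≋generators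

corollary2p2 : (ℝ : RealField) → (C : WithReals.Subset ℝ) →
    WithReals.IsSet ℝ C →
    (∀ u → C u → WithReals.InR∞ ℝ u × WithReals.Nonneg ℝ u) →
    WithReals.IsCone ℝ C →
    WithReals.SymInvariant ℝ C →
    (WithReals.EqFinGen ℝ C ⇔
       (WithReals.Stabilizes ℝ (WithReals.Cbar ℝ C) ×
        (∀ n → 1 ≤ n → WithReals.FinGen ℝ (WithReals.Cbar ℝ C n))))
    × (WithReals.EqFinGen ℝ C ⇔ WithReals.BoundedSupportGen ℝ C)
corollary2p2 ℝ C C-set C-pos C-cone C-inv =
  mk⇔ (BoundedSupportGen⇒stable ∘ EqFinGen⇒BoundedSupportGen) (uncurry stable⇒EqFinGen) ,
  mk⇔ EqFinGen⇒BoundedSupportGen (uncurry stable⇒EqFinGen ∘ BoundedSupportGen⇒stable)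
  where open Equivalences ℝ C C-set C-pos C-cone C-inv
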